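{- In the notation of the context, the homomorphism $\mathbf i:\mathcal M=W_B/W_e\to\widetilde{\mathcal M}=\widetilde W_B/\widetilde W_e$ induced by $w\mapsto (w,\mathrm{Id})$ is injective.
   Context: Let $\mathcal A$ be a coefficient-free cluster algebra of rank $n$ with initial seed $((x_1,\dots,x_n),B)$. Let $W=\mathbb Z_2*\cdots*\mathbb Z_2$ ($n$ copies), viewed as words $w=i_1\cdots i_k$ in $\{1,\dots,n\}$ without equal consecutive letters; $w$ acts on seeds by $\mu_w=\mu_{i_k}\circ\cdots\circ\mu_{i_1}$. $W_e$ is the subgroup of words $w$ such that the $i$-th cluster variable of $\mu_w$(initial seed) equals $x_i$ for all $i$; $W_B$ is the subgroup of words with $\mu_w$ preserving the exchange matrix $B$. The symmetric group $\Sigma_n$ acts on seeds by relabelling indices ($x_i\mapsto x_{\sigma(i)}$, $B\mapsto M_\sigma^{ -1}BM_\sigma$ for the permutation matrix $M_\sigma$) and on $W$ by permuting letters. The group of enhanced words is $\widetilde W=W\times\Sigma_n$ with product $(w_1,\sigma_1)(w_2,\sigma_2)=(w_1\sigma_1^{ -1}(w_2),\sigma_1\sigma_2)$, and $(w,\sigma)$ acts on seeds by $\sigma\circ\mu_w$. $\widetilde W_e$ is the subgroup of enhanced words fixing every initial cluster variable $x_i$ (in position $i$), and $\widetilde W_B$ the subgroup of enhanced words preserving $B$. Since $(W_e,\mathrm{Id})\subseteq\widetilde W_e$ and $(W_B,\mathrm{Id})\subseteq\widetilde W_B$, the map $w\mapsto(w,\mathrm{Id})$ induces a homomorphism $\mathbf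 i:W_B/W_e\to\widetilde W_B/\widetilde W_e$. -}

module Defs where

open import Data.Nat as ℕ using (ℕ; zero; suc; pred)
open import Data.Integer as ℤ using (ℤ; +_; -[1+_])
open import Data.Fin using (Fin; zero; suc; _≟_)
open import Data.Fin.Permutation using (Permutation′; _⟨$⟩ʳ_; _⟨$⟩ˡ_; flip; _∘ₚ_; id)
open import Data.List using (List; []; _∷_; reverse; _ʳ++_; map; foldl)
open import Data.List.Relation.Unary.Linked using (Linked)
open import Data.Product using (Σ; _×_; _,_; ∃)
open import Relation.Binary.PropositionalEquality using (_≡_; _≢_)
open import Relation.Nullary using (yes; no)

record Q⁺ : Set where
  constructor _/⁺_
  field
    nm dn : ℕ   -- represents (suc nm) / (suc dn)

open Q⁺ public

infix 4 _≈⁺_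
_≈⁺_ : Q⁺ → Q⁺ → Set
p ≈⁺ q = suc (nm p) ℕ.* suc (dn q) ≡ suc (nm q) ℕ.* suc (dn p)

one⁺ : Q⁺
one⁺ = 0 /⁺ 0

_*⁺_ : Q⁺ → Q⁺ → Q⁺
p *⁺ q = pred (suc (nm p) ℕ.* suc (nm q)) /⁺ pred (suc (dn p) ℕ.* suc (dn q))

_+⁺_ : Q⁺ → Q⁺ → Q⁺
p +⁺ q = pred (suc (nm p) ℕ.* suc (dn q) ℕ.+ suc (nm q) ℕ.* suc (dn p))
         /⁺ pred (suc (dn p) ℕ.* suc (dn q))

inv⁺ : Q⁺ → Q⁺
inv⁺ p = dn p /⁺ nm p

_^⁺_ : Q⁺ → ℕ → Q⁺
p ^⁺ zero  = one⁺
p ^⁺ suc k = p *⁺ (p ^⁺ k)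

prodFin : ∀ {n} → (Fin n → Q⁺) → Q⁺
prodFin {zero}  f = one⁺
prodFin {suc n} f = f zero *⁺ prodFin (λ i → f (suc i))

-- Rational functions in x₁..xₙ (subtraction-free), represented by their
-- values at positive rational points; equality = equality as functions,
-- which coincides with equality in ℚ(x₁,…,xₙ) since ℚ_{>0}^n is Zariski dense.

Point : ℕ → Set
Point n = Fin n → Q⁺

RatFun : ℕ → Set
RatFun n = Point n → Q⁺

infix 4 _≈ᶠ_
_≈ᶠ_ : ∀ {n} → RatFun n → RatFun n → Set
f ≈ᶠ g = ∀ p → f p ≈⁺ g p

var : ∀ {n} → Fin n → RatFun n
var i p = p i

Matrix : ℕ → Set
Matrix n = Fin n → Fin n → ℤ

SkewSymmetrizable : ∀ {n} → Matrix n → Set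
SkewSymmetrizable {n} B =
  Σ (Fin n → ℕ) λ d → (∀ i → d i ≢ 0) ×
    (∀ i j → (+ d i) ℤ.* B i j ≡ ℤ.- ((+ d j) ℤ.* B j i))

[_]₊ : ℤ → ℕ
[ + m ]₊    = m
[ -[1+ m ] ]₊ = 0

record Seed (n : ℕ) : Set where
  constructor seed
  field
    cl  : Fin n → RatFun n
    mat : Matrix n

open Seed public

initialSeed : ∀ {n} → Matrix n → Seed n
initialSeed B = seed var B

mutMat : ∀ {n} → Fin n → Matrix n → Matrix n
mutMat k B i j with i ≟ k | j ≟ k
... | yes _ | _     = ℤ.- B i j
... | no _  | yes _ = ℤ.- B i j
... | no _  | no _  = B i j ℤ.+ (+ ([ B i k ]₊ ℕ.* [ B k j ]₊))
                            ℤ.- (+ ([ ℤ.- B i k ]₊ ℕ.* [ ℤ.- B k j ]₊))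

mutate : ∀ {n} → Fin n → Seed n → Seed n
mutate {n} k (seed x B) = seed x' (mutMat k B)
  where
  x' : Fin n → RatFun n
  x' j p with j ≟ k
  ... | no _  = x j p
  ... | yes _ =
    (prodFin (λ i → x i p ^⁺ [ B i k ]₊) +⁺ prodFin (λ i → x i p ^⁺ [ ℤ.- B i k ]₊))
      *⁺ inv⁺ (x k p)

-- relabelling by σ : x_i ↦ x_{σ(i)}, B ↦ M_σ⁻¹ B M_σ
relabel : ∀ {n} → Permutation′ n → Seed n → Seed n
relabel σ (seed x B) =
  seed (λ j → x (σ ⟨$⟩ˡ j)) (λ i j → B (σ ⟨$⟩ˡ i) (σ ⟨$⟩ˡ j))

-- Words: W = Z₂ * ... * Z₂, elements = reduced words

RawWord : ℕ → Set
RawWord n = List (Fin n)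

W : ℕ → Set
W n = Σ (RawWord n) (Linked _≢_)

μ : ∀ {n} → RawWord n → Seed n → Seed n
μ w s = foldl (λ t k → mutate k t) s w

-- group law on words: concatenation followed by free reduction
private
  mulRev : ∀ {n} → RawWord n → RawWord n → RawWord n
  mulRev []       ys       = ys
  mulRev (x ∷ xs) []       = (x ∷ xs) ʳ++ []
  mulRev (x ∷ xs) (y ∷ ys) with x ≟ y
  ... | yes _ = mulRev xs ys
  ... | no _  = (x ∷ xs) ʳ++ (y ∷ ys)

infixl 7 _·_
_·_ : ∀ {n} → RawWord n → RawWord n → RawWord n
u · v = mulRev (reverse u) v

winv : ∀ {n} → RawWord n → RawWord n
winv = reverse

permW : ∀ {n} → Permutation′ n → RawWord n → RawWord n
permW σ = map (σ ⟨$⟩ʳ_)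

InWe : ∀ {n} → Matrix n → RawWord n → Set
InWe {n} B w = ∀ (i : Fin n) → cl (μ w (initialSeed B)) i ≈ᶠ var i

InWB : ∀ {n} → Matrix n → RawWord n → Set
InWB {n} B w = ∀ (i j : Fin n) → mat (μ w (initialSeed B)) i j ≡ B i j

-- left coset relation for M = W_B / W_e
_∼[_]_ : ∀ {n} → RawWord n → Matrix n → RawWord n → Set
w₁ ∼[ B ] w₂ = InWe B (winv w₁ · w₂)

EWord : ℕ → Set
EWord n = RawWord n × Permutation′ n

_⊙_ : ∀ {n} → EWord n → EWord n → EWord n
(w₁ , σ₁) ⊙ (w₂ , σ₂) = (w₁ · permW (flip σ₁) w₂ , σ₂ ∘ₚ σ₁)

einv : ∀ {n} → EWord n → EWord n
einv (w , σ) = (permW σ (winv w) , flip σ)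

eact : ∀ {n} → EWord n → Seed n → Seed n
eact (w , σ) s = relabel σ (μ w s)

InW̃e : ∀ {n} → Matrix n → EWord n → Set
InW̃e {n} B u = ∀ (i : Fin n) → cl (eact u (initialSeed B)) i ≈ᶠ var i

InW̃B : ∀ {n} → Matrix n → EWord n → Set
InW̃B {n} B u = ∀ (i j : Fin n) → mat (eact u (initialSeed B)) i j ≡ B i j

-- left coset relation for M̃ = W̃_B / W̃_e
_∼̃[_]_ : ∀ {n} → EWord n → Matrix n → EWord n → Set
u ∼̃[ B ] v = InW̃e B (einv u ⊙ v)

𝐢 : ∀ {n} → W n → EWord n
𝐢 (w , _) = (w , id)

{-# OPTIONS --safe #-}
module Submission where

open import Defs
open import Data.Nat using (ℕ)
open import Data.Product using (proj₁; _,_)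
open import Data.Fin.Permutation using (Permutation′; _⟨$⟩ʳ_; _⟨$⟩ˡ_; flip; _∘ₚ_; id)
open import Data.List.Properties using (map-cong; map-id)
open import Relation.Binary.PropositionalEquality using (_≡_; refl; trans; subst; cong₂)

permW-fixing : ∀ {n} (σ : Permutation′ n) → (∀ i → σ ⟨$⟩ʳ i ≡ i) →
               ∀ w → permW σ w ≡ w
permW-fixing σ fix w = trans (map-cong fix w) (map-id w)

InW̃e⇒InWe : ∀ {n} (B : Matrix n) (w : RawWord n) (σ : Permutation′ n) →
            (∀ i → σ ⟨$⟩ˡ i ≡ i) → InW̃e B (w , σ) → InWe B w
InW̃e⇒InWe B w σ fix h i =
  subst (λ j → cl (μ w (initialSeed B)) j ≈ᶠ var i) (fix i) (h i)

lemma4p12 : ∀ (n : ℕ) (B : Matrix n) → SkewSymmetrizable B →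
                ∀ (w₁ w₂ : W n) → InWB B (proj₁ w₁) → InWB B (proj₁ w₂) →
                𝐢 w₁ ∼̃[ B ] 𝐢 w₂ → proj₁ w₁ ∼[ B ] proj₁ w₂
lemma4p12 n B _ (w₁ , _) (w₂ , _) _ _ h =
  subst (InWe B) quotient-word
    (InW̃e⇒InWe B (permW id (winv w₁) · permW (flip id) w₂) (id ∘ₚ flip id) (λ _ → refl) h)
  where
  quotient-word : permW id (winv w₁) · permW (flip id) w₂ ≡ winv w₁ · w₂
  quotient-word = cong₂ _·_ (permW-fixing id (λ _ → refl) (winv w₁))
                            (permW-fixing (flip id) (λ _ → refl) w₂)
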